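{- For every positive integer $n$, the number of possible positions of the robotic arm $SR_n$ equals the $(n+2)$-th Fibonacci number $F_{n+2}=\frac{1}{\sqrt5}\left(\left(\frac{1+\sqrt5}{2}\right)^{n+2}-\left(\frac{1-\sqrt5}{2}\right)^{n+2}\right)$.
   Context: A position of the robotic arm $SR_n$ is a path of $n$ unit links attached sequentially, starting at $(0,0)$ and contained in the $1\times n$ grid $[0,n]\times[0,1]$, in which each link faces north, south, or east, and which never visits the same point twice. -}

module Defs where

open import Data.Nat using (ℕ; zero; suc; _+_)
open import Data.Integer as ℤ using (ℤ; 0ℤ; 1ℤ; +_; -1ℤ)
import Data.Integer.Properties as ℤP
open import Data.Product using (_×_; _,_)
open import Data.Product.Properties using (≡-dec)
open import Data.List using (List; []; _∷_; map; concatMap; filter; length)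
open import Data.Vec using (Vec; []; _∷_)
open import Data.List.Relation.Unary.All using (All; all?)
open import Data.List.Relation.Unary.Unique.Propositional using (Unique)
import Data.List.Relation.Unary.Unique.DecPropositional as UDec
open import Relation.Nullary using (Dec)
open import Relation.Nullary.Decidable using (_×-dec_)
open import Relation.Binary using (DecidableEquality)

data Dir : Set where
  N S E : Dir

Point : Set
Point = ℤ × ℤ

_≟P_ : DecidableEquality Point
_≟P_ = ≡-dec ℤ._≟_ ℤ._≟_

step : Dir → Point → Point
step N (x , y) = (x , y ℤ.+ 1ℤ)
step S (x , y) = (x , y ℤ.+ -1ℤ)
step E (x , y) = (x ℤ.+ 1ℤ , y)

pointsFrom : ∀ {n} → Point → Vec Dir n → List Point
pointsFrom p []       = p ∷ []
pointsFrom p (d ∷ ds) = p ∷ pointsFrom (step d p) ds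

points : ∀ {n} → Vec Dir n → List Point
points = pointsFrom (0ℤ , 0ℤ)

InGrid : ℕ → Point → Set
InGrid n (x , y) = (0ℤ ℤ.≤ x × x ℤ.≤ + n) × (0ℤ ℤ.≤ y × y ℤ.≤ 1ℤ)

inGrid? : ∀ n (p : Point) → Dec (InGrid n p)
inGrid? n (x , y) = ((0ℤ ℤ.≤? x) ×-dec (x ℤ.≤? + n)) ×-dec ((0ℤ ℤ.≤? y) ×-dec (y ℤ.≤? 1ℤ))

-- A position of SR_n: n links (each N, S or E) from (0,0), staying in the
-- grid and never visiting the same point twice.
IsPosition : (n : ℕ) → Vec Dir n → Set
IsPosition n ds = All (InGrid n) (points ds) × Unique (points ds)

isPosition? : (n : ℕ) (ds : Vec Dir n) → Dec (IsPosition n ds)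
isPosition? n ds = all? (inGrid? n) (points ds) ×-dec UDec.unique? _≟P_ (points ds)

allDirs : List Dir
allDirs = N ∷ S ∷ E ∷ []

allVecs : (n : ℕ) → List (Vec Dir n)
allVecs zero    = [] ∷ []
allVecs (suc n) = concatMap (λ d → map (d ∷_) (allVecs n)) allDirs

numPositions : ℕ → ℕ
numPositions n = length (filter (isPosition? n) (allVecs n))

fib : ℕ → ℕ
fib zero          = 0
fib (suc zero)    = 1
fib (suc (suc n)) = fib (suc n) + fib n

-- A point of an arm never lies left of an earlier one, so an arm can only revisit a point by
-- moving N then S or S then N within one column.  Confined to the two rows y = 0 and y = 1
-- (the x-bounds of the grid hold automatically), every vertical link must therefore switch
-- rows and be followed by an E link unless it is the last one.  Let a k count such words of
-- length k from either row; sorting them by their first letters (E, or the vertical link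
-- followed by E) gives a (k + 2) = a (k + 1) + a k with a 0 = 1 and a 1 = 2, so a k = F (k + 2).
module Submission where

open import Defs
open import Data.Bool using (Bool; true; false; T)
open import Data.Nat using (ℕ; zero; suc; _+_; _≥_; s≤s; z≤n)
open import Data.Nat.Properties using (+-comm; +-identityʳ)
open import Data.Integer as ℤ using (ℤ; 0ℤ; 1ℤ; +_; +≤+)
import Data.Integer.Properties as ℤ
open import Data.Product using (_×_; _,_; proj₁; proj₂)
open import Data.List using (List; []; _∷_; _++_; map; filter; length; concatMap)
open import Data.Nat.ListAction using (sum)
open import Data.List.Properties using (filter-++; filter-none; filter-≐; length-++)
open import Data.List.Relation.Unary.All as All using (All; []; _∷_)
open import Data.List.Relation.Unary.AllPairs using ([]; _∷_)
open import Data.List.Relation.Unary.Unique.Propositional using (Unique)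
open import Data.Vec using (Vec; []; _∷_)
open import Data.Empty using (⊥-elim)
open import Function using (_∘_)
open import Level using (Level)
open import Relation.Nullary using (¬_; Dec; does)
open import Relation.Nullary.Decidable using (T?)
open import Relation.Unary using (Pred; Decidable; _≐_)
open import Relation.Binary.PropositionalEquality using (_≡_; _≢_; refl; trans; cong; cong₂; module ≡-Reasoning)

private variable
  a p : Level
  k : ℕ

count : {A : Set a} {P : Pred A p} → Decidable P → List A → ℕ
count P? xs = length (filter P? xs)

module _ {A : Set a} {P : Pred A p} (P? : Decidable P) where

  count-++ : ∀ xs ys → count P? (xs ++ ys) ≡ count P? xs + count P? ys
  count-++ xs ys = trans (cong length (filter-++ P? xs ys)) (length-++ (filter P? xs))

  count-map : ∀ {b} {B : Set b} (f : B → A) xs → count P? (map f xs) ≡ count (P? ∘ f) xs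
  count-map f [] = refl
  count-map f (x ∷ xs) with does (P? (f x))
  ... | true  = cong suc (count-map f xs)
  ... | false = count-map f xs

  count-none : (∀ x → ¬ P x) → ∀ xs → count P? xs ≡ 0
  count-none ¬P xs = cong length (filter-none P? (All.universal ¬P xs))

count-allVecs-suc : ∀ k {P : Pred (Vec Dir (suc k)) p} (P? : Decidable P) →
  count P? (allVecs (suc k)) ≡ count (P? ∘ (N ∷_)) (allVecs k)
                             + (count (P? ∘ (S ∷_)) (allVecs k) + count (P? ∘ (E ∷_)) (allVecs k))
count-allVecs-suc k P? =
  trans (count-prefixes allDirs) (cong (λ c → first N + (first S + c)) (+-identityʳ (first E)))
  where
  first : Dir → ℕ
  first d = count (P? ∘ (d ∷_)) (allVecs k)

  count-prefixes : ∀ ds → count P? (concatMap (λ d → map (d ∷_) (allVecs k)) ds)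
                        ≡ sum (map first ds)
  count-prefixes []       = refl
  count-prefixes (d ∷ ds) = trans (count-++ P? (map (d ∷_) (allVecs k)) _)
                                  (cong₂ _+_ (count-map P? (d ∷_) (allVecs k)) (count-prefixes ds))

InStrip : Point → Set
InStrip (_ , y) = 0ℤ ℤ.≤ y × y ℤ.≤ 1ℤ

StripArm : Point → Vec Dir k → Set
StripArm p ds = All InStrip (pointsFrom p ds) × Unique (pointsFrom p ds)

pointsFrom-head : ∀ {Q : Point → Set} p (ds : Vec Dir k) → All Q (pointsFrom p ds) → Q p
pointsFrom-head p []      (q ∷ _) = q
pointsFrom-head p (_ ∷ _) (q ∷ _) = q

step-x≥ : ∀ d q → proj₁ q ℤ.≤ proj₁ (step d q)
step-x≥ N _       = ℤ.≤-refl
step-x≥ S _       = ℤ.≤-refl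
step-x≥ E (x , _) = ℤ.i≤i+j x 1ℤ

step-x≤ : ∀ d q → proj₁ (step d q) ℤ.≤ proj₁ q ℤ.+ 1ℤ
step-x≤ N (x , _) = ℤ.i≤i+j x 1ℤ
step-x≤ S (x , _) = ℤ.i≤i+j x 1ℤ
step-x≤ E _       = ℤ.≤-refl

pointsFrom-x≥ : ∀ q (ds : Vec Dir k) → All (λ r → proj₁ q ℤ.≤ proj₁ r) (pointsFrom q ds)
pointsFrom-x≥ q []       = ℤ.≤-refl ∷ []
pointsFrom-x≥ q (d ∷ ds) = ℤ.≤-refl ∷ All.map (ℤ.≤-trans (step-x≥ d q)) (pointsFrom-x≥ (step d q) ds)

pointsFrom-x≤ : ∀ q (ds : Vec Dir k) → All (λ r → proj₁ r ℤ.≤ proj₁ q ℤ.+ + k) (pointsFrom q ds)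
pointsFrom-x≤         q []       = ℤ.i≤i+j (proj₁ q) (+ 0) ∷ []
pointsFrom-x≤ {suc k} q (d ∷ ds) =
  ℤ.i≤i+j (proj₁ q) (+ suc k) ∷ All.map bound (pointsFrom-x≤ (step d q) ds)
  where
  bound : ∀ {x} → x ℤ.≤ proj₁ (step d q) ℤ.+ + k → x ℤ.≤ proj₁ q ℤ.+ + suc k
  bound x≤ = ℤ.≤-trans x≤ (ℤ.≤-trans (ℤ.+-monoˡ-≤ (+ k) (step-x≤ d q))
                                      (ℤ.≤-reflexive (ℤ.+-assoc (proj₁ q) 1ℤ (+ k))))

pointsFrom-∌ : ∀ {x} y q (ds : Vec Dir k) → x ℤ.< proj₁ q → All ((x , y) ≢_) (pointsFrom q ds)
pointsFrom-∌ y q ds x<q =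
  All.map (λ q≤r eq → ℤ.<-irrefl (cong proj₁ eq) (ℤ.<-≤-trans x<q q≤r)) (pointsFrom-x≥ q ds)

pointsFrom-right-∌ : ∀ {x y y'} (ds : Vec Dir k) →
                     All ((x , y) ≢_) (pointsFrom (x ℤ.+ 1ℤ , y') ds)
pointsFrom-right-∌ {x = x} ds = pointsFrom-∌ _ _ ds (ℤ.suc[i]≤j⇒i<j (ℤ.≤-reflexive (ℤ.+-comm 1ℤ x)))

data Row : Set where
  bottom top : Row

height : Row → ℤ
height bottom = 0ℤ
height top    = 1ℤ

opposite : Row → Row
opposite bottom = top
opposite top    = bottom

height-inStrip : ∀ x u → InStrip (x , height u)
height-inStrip x bottom = +≤+ z≤n , +≤+ z≤n
height-inStrip x top    = +≤+ z≤n , +≤+ (s≤s z≤n)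

admissible : Row → Vec Dir k → Bool
admissible u      []           = true
admissible u      (E ∷ ds)     = admissible u ds
admissible bottom (N ∷ [])     = true
admissible bottom (N ∷ E ∷ ds) = admissible top ds
admissible top    (S ∷ [])     = true
admissible top    (S ∷ E ∷ ds) = admissible bottom ds
admissible _      _            = false

admissible⇒stripArm : ∀ u x (ds : Vec Dir k) → T (admissible u ds) → StripArm (x , height u) ds
admissible⇒stripArm u x [] _ = (height-inStrip x u ∷ []) , ([] ∷ [])
admissible⇒stripArm u x (E ∷ ds) adm =
  let strip , unique = admissible⇒stripArm u (x ℤ.+ 1ℤ) ds adm
  in  (height-inStrip x u ∷ strip) , (pointsFrom-right-∌ ds ∷ unique)
admissible⇒stripArm bottom x (N ∷ []) _ =
  (height-inStrip x bottom ∷ height-inStrip x top ∷ []) , (((λ ()) ∷ []) ∷ [] ∷ [])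
admissible⇒stripArm bottom x (N ∷ E ∷ ds) adm =
  let strip , unique = admissible⇒stripArm top (x ℤ.+ 1ℤ) ds adm
  in  (height-inStrip x bottom ∷ height-inStrip x top ∷ strip) ,
      (((λ ()) ∷ pointsFrom-right-∌ ds) ∷ pointsFrom-right-∌ ds ∷ unique)
admissible⇒stripArm top x (S ∷ []) _ =
  (height-inStrip x top ∷ height-inStrip x bottom ∷ []) , (((λ ()) ∷ []) ∷ [] ∷ [])
admissible⇒stripArm top x (S ∷ E ∷ ds) adm =
  let strip , unique = admissible⇒stripArm bottom (x ℤ.+ 1ℤ) ds adm
  in  (height-inStrip x top ∷ height-inStrip x bottom ∷ strip) ,
      (((λ ()) ∷ pointsFrom-right-∌ ds) ∷ pointsFrom-right-∌ ds ∷ unique)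
admissible⇒stripArm bottom x (N ∷ N ∷ _) ()
admissible⇒stripArm bottom x (N ∷ S ∷ _) ()
admissible⇒stripArm bottom x (S ∷ _)     ()
admissible⇒stripArm top    x (N ∷ _)     ()
admissible⇒stripArm top    x (S ∷ N ∷ _) ()
admissible⇒stripArm top    x (S ∷ S ∷ _) ()

stripArm⇒admissible : ∀ u x (ds : Vec Dir k) → StripArm (x , height u) ds → T (admissible u ds)
stripArm⇒admissible u x [] _ = _
stripArm⇒admissible u x (E ∷ ds) (_ ∷ strip , _ ∷ unique) =
  stripArm⇒admissible u (x ℤ.+ 1ℤ) ds (strip , unique)
stripArm⇒admissible bottom x (N ∷ []) _ = _
stripArm⇒admissible bottom x (N ∷ E ∷ ds) (_ ∷ _ ∷ strip , _ ∷ _ ∷ unique) =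
  stripArm⇒admissible top (x ℤ.+ 1ℤ) ds (strip , unique)
stripArm⇒admissible top x (S ∷ []) _ = _
stripArm⇒admissible top x (S ∷ E ∷ ds) (_ ∷ _ ∷ strip , _ ∷ _ ∷ unique) =
  stripArm⇒admissible bottom (x ℤ.+ 1ℤ) ds (strip , unique)
stripArm⇒admissible bottom x (N ∷ N ∷ ds) (_ ∷ _ ∷ strip , _)
  with +≤+ (s≤s ()) ← proj₂ (pointsFrom-head _ ds strip)
stripArm⇒admissible bottom x (N ∷ S ∷ ds) (_ , (_ ∷ fresh) ∷ _) =
  ⊥-elim (pointsFrom-head _ ds fresh refl)
stripArm⇒admissible bottom x (S ∷ ds) (_ ∷ strip , _)
  with () ← proj₁ (pointsFrom-head _ ds strip)
stripArm⇒admissible top x (N ∷ ds) (_ ∷ strip , _)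
  with +≤+ (s≤s ()) ← proj₂ (pointsFrom-head _ ds strip)
stripArm⇒admissible top x (S ∷ S ∷ ds) (_ ∷ _ ∷ strip , _)
  with () ← proj₁ (pointsFrom-head _ ds strip)
stripArm⇒admissible top x (S ∷ N ∷ ds) (_ , (_ ∷ fresh) ∷ _) =
  ⊥-elim (pointsFrom-head _ ds fresh refl)

stripArm⇒inGrid : ∀ {n} (ds : Vec Dir n) → All InStrip (points ds) → All (InGrid n) (points ds)
stripArm⇒inGrid ds strip =
  All.zipWith (λ { {_ , _} (xBounds , yBounds) → xBounds , yBounds })
              (All.zip (pointsFrom-x≥ _ ds , pointsFrom-x≤ _ ds) , strip)

isPosition≐admissible : ∀ n → IsPosition n ≐ (T ∘ admissible bottom)
isPosition≐admissible n =
  (λ {ds} (inGrid , unique) →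
     stripArm⇒admissible bottom 0ℤ ds (All.map (λ { {_ , _} → proj₂ }) inGrid , unique)) ,
  (λ {ds} adm → let strip , unique = admissible⇒stripArm bottom 0ℤ ds adm
                in  stripArm⇒inGrid ds strip , unique)

admissible? : ∀ u (ds : Vec Dir k) → Dec (T (admissible u ds))
admissible? u ds = T? (admissible u ds)

numAdmissible : Row → ℕ → ℕ
numAdmissible u k = count (admissible? u) (allVecs k)

numAdmissible-suc-suc : ∀ u j →
  numAdmissible u (2 + j) ≡ numAdmissible (opposite u) j + numAdmissible u (suc j)
numAdmissible-suc-suc bottom j =
  trans (count-allVecs-suc (suc j) (admissible? bottom))
        (cong₂ _+_ crossing (cong₂ _+_ (count-none (after S) (λ _ ()) (allVecs (suc j))) refl))
  where
  after : ∀ d (ds : Vec Dir (suc j)) → Dec (T (admissible bottom (d ∷ ds)))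
  after d ds = admissible? bottom (d ∷ ds)
  crossing : count (after N) (allVecs (suc j)) ≡ numAdmissible top j
  crossing = trans (count-allVecs-suc j (after N))
                   (cong₂ _+_ (count-none (λ ds → after N (N ∷ ds)) (λ _ ()) (allVecs j))
                              (cong₂ _+_ (count-none (λ ds → after N (S ∷ ds)) (λ _ ()) (allVecs j)) refl))
numAdmissible-suc-suc top j =
  trans (count-allVecs-suc (suc j) (admissible? top))
        (cong₂ _+_ (count-none (after N) (λ _ ()) (allVecs (suc j))) (cong₂ _+_ crossing refl))
  where
  after : ∀ d (ds : Vec Dir (suc j)) → Dec (T (admissible top (d ∷ ds)))
  after d ds = admissible? top (d ∷ ds)
  crossing : count (after S) (allVecs (suc j)) ≡ numAdmissible bottom j
  crossing = trans (count-allVecs-suc j (after S))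
                   (cong₂ _+_ (count-none (λ ds → after S (N ∷ ds)) (λ _ ()) (allVecs j))
                              (cong₂ _+_ (count-none (λ ds → after S (S ∷ ds)) (λ _ ()) (allVecs j)) refl))

numAdmissible≡fib : ∀ u k → numAdmissible u k ≡ fib (2 + k)
numAdmissible≡fib u      zero          = refl
numAdmissible≡fib bottom (suc zero)    = refl
numAdmissible≡fib top    (suc zero)    = refl
numAdmissible≡fib u      (suc (suc j)) = begin
    numAdmissible u (2 + j)
  ≡⟨ numAdmissible-suc-suc u j ⟩
    numAdmissible (opposite u) j + numAdmissible u (suc j)
  ≡⟨ cong₂ _+_ (numAdmissible≡fib (opposite u) j) (numAdmissible≡fib u (suc j)) ⟩
    fib (2 + j) + fib (3 + j)
  ≡⟨ +-comm (fib (2 + j)) _ ⟩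
    fib (4 + j) ∎
  where open ≡-Reasoning

lemma3p5 : (n : ℕ) → n ≥ 1 → numPositions n ≡ fib (n + 2)
lemma3p5 n _ = begin
    numPositions n
  ≡⟨ cong length (filter-≐ (isPosition? n) _ (isPosition≐admissible n) (allVecs n)) ⟩
    numAdmissible bottom n
  ≡⟨ numAdmissible≡fib bottom n ⟩
    fib (2 + n)
  ≡⟨ cong fib (+-comm 2 n) ⟩
    fib (n + 2) ∎
  where open ≡-Reasoning
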